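{- Let $N\ge 3$ and let ${\bf S}_C\in\mathbb{R}^{N\times N}$ be the circulant incidence matrix of the (unweighted) simple cycle on vertices $0,\dots,N-1$, with first row $[1\ -1\ 0\ \dots\ 0]$. Then the Moore–Penrose pseudoinverse ${\bf S}_C^{\dagger}$ has entries \[S_C^{\dagger}(i,j)=\frac{N-1}{2N}-\frac{j-i}{N}\qquad\text{for } 0\le i\le j\le N-1,\] and its rows and columns are piecewise linear polynomials.
   Context: A circulant matrix with first row $[c_0\ c_1\ \dots\ c_{N-1}]$ has $(i,j)$ entry $c_{(j-i)\bmod N}$. Indices are zero-based. A vector ${\bf p}\in\mathbb{R}^N$ is a piecewise polynomial of degree at most $D$ if there exist $0=t_1<t_2<\dots<t_{K+1}=N$ such that, for each $j$, $p(i)$ agrees for $t_j\le i<t_{j+1}$ with a polynomial in $i$ of degree at most $D$; piecewise linear means $D=1$.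
   Formalization: The matrices, including ${\bf S}_C$ and every candidate pseudoinverse, have entries in ℚ rather than ℝ, and the polynomials describing the rows and columns have rational coefficients. -}

module Defs where

open import Data.Nat as ℕ using (ℕ; zero; suc; _≤_; _<_; _∸_; _%_)
open import Data.Fin using (Fin; toℕ)
import Data.Fin as F
open import Data.Integer using (ℤ; +_)
open import Data.Rational using (ℚ; 0ℚ; 1ℚ; _+_; _*_; -_; _/_)
open import Data.Vec using (Vec; []; _∷_)
open import Data.Product using (_×_)
open import Relation.Binary.PropositionalEquality using (_≡_)

-- Real N×N matrices, restricted to rational entries
Matrix : ℕ → Set
Matrix N = Fin N → Fin N → ℚ

Σ : ∀ n → (Fin n → ℚ) → ℚ
Σ zero    f = 0ℚ
Σ (suc n) f = f F.zero + Σ n (λ k → f (F.suc k))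

_⊗_ : ∀ {N} → Matrix N → Matrix N → Matrix N
(A ⊗ B) i j = Σ _ (λ k → A i k * B k j)

transpose : ∀ {N} → Matrix N → Matrix N
transpose A i j = A j i

-- Circulant matrix with first row c_0 … c_{N-1}: (i,j) entry c_{(j-i) mod N}
circulant : ∀ N → (ℕ → ℚ) → Matrix N
circulant (suc m) c i j = c ((toℕ j ℕ.+ suc m ∸ toℕ i) % suc m)

cycleRow : ℕ → ℚ
cycleRow 0 = 1ℚ
cycleRow 1 = - 1ℚ
cycleRow _ = 0ℚ

S-C : ∀ N → Matrix N
S-C N = circulant N cycleRow

IsPseudoinverse : ∀ {N} → Matrix N → Matrix N → Set
IsPseudoinverse A X =
  (∀ i j → ((A ⊗ X) ⊗ A) i j ≡ A i j) ×
  (∀ i j → ((X ⊗ A) ⊗ X) i j ≡ X i j) ×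
  (∀ i j → transpose (A ⊗ X) i j ≡ (A ⊗ X) i j) ×
  (∀ i j → transpose (X ⊗ A) i j ≡ (X ⊗ A) i j)

-- p / d as a rational (d = 0 gives 0; never used with d = 0)
_//_ : ℤ → ℕ → ℚ
p // zero  = 0ℚ
p // suc d = p / suc d

ℕtoℚ : ℕ → ℚ
ℕtoℚ n = + n / 1

evalPoly : ∀ {n} → Vec ℚ n → ℚ → ℚ
evalPoly []       x = 0ℚ
evalPoly (c ∷ cs) x = c + x * evalPoly cs x

-- Pieces D p a b : the range [a, b) is split as a = t_1 < t_2 < … < t_{K+1} = b
-- with p agreeing on each [t_j, t_{j+1}) with a polynomial of degree ≤ D.
data Pieces (D : ℕ) {N : ℕ} (p : Fin N → ℚ) : ℕ → ℕ → Set where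
  done : ∀ {b} → Pieces D p b b
  seg  : ∀ {a c b} → a < c → (cs : Vec ℚ (suc D)) →
         (∀ (i : Fin N) → a ≤ toℕ i → toℕ i < c → p i ≡ evalPoly cs (ℕtoℚ (toℕ i))) →
         Pieces D p c b → Pieces D p a b

PiecewisePoly : ℕ → ∀ {N} → (Fin N → ℚ) → Set
PiecewisePoly D {N} p = Pieces D p 0 N

PiecewiseLinear : ∀ {N} → (Fin N → ℚ) → Set
PiecewiseLinear = PiecewisePoly 1

module Submission where

-- Write Δ i j = (j − i) mod N for the cyclic offset and next/prev for the
-- cyclic shift on Fin N, so that S i j = cycleRow (Δ i j), i.e. S = I − P.
-- The candidate is the circulant matrix
--     S⁺ i j = profile (Δ i j),   profile x = (N − 1)/(2N) − x/N.
-- The profile drops by 1/N per step and rises by 1 − 1/N when the cycle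
-- closes, so S ⊗ S⁺ and S⁺ ⊗ S both equal the symmetric centring matrix
-- I − J/N; together with the vanishing row sums of S⁺ (equal along the cycle,
-- zero at the first row by Gauss's sum) this gives the four Penrose
-- conditions.  Every pseudoinverse X equals S⁺ by uniqueness of the
-- Moore–Penrose inverse.  For i ≤ j the offset is j − i, which is the entry
-- formula, and each row and column of S⁺ is affine on either side of the
-- diagonal.  The argument works for all N ≥ 2.

open import Data.Nat using (ℕ; _≤_)

module RationalEmbedding where

  open import Defs
  open import Data.Nat as ℕ using (zero; suc)
  import Data.Nat.Properties as ℕP
  open import Data.Integer as ℤ using (+_)
  open import Data.Rational using (1ℚ; _+_; _*_; _/_; toℚᵘ)
  import Data.Rational.Properties as ℚP
  open import Data.Rational.Unnormalised as ℚᵘ using (mkℚᵘ; *≡*)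
  import Data.Rational.Unnormalised.Properties as ℚᵘP
  import Relation.Binary.Reasoning.Setoid as SetoidReasoning
  open import Relation.Binary.PropositionalEquality
  open import Data.Nat.Tactic.RingSolver using (solve-∀)

  open SetoidReasoning ℚᵘP.≃-setoid

  -- The successor step of the embedding ℕ → ℚ, checked in the unnormalised
  -- rationals where it is a statement about numerators and denominators.
  ℕtoℚ-suc : ∀ n → ℕtoℚ (suc n) ≡ 1ℚ + ℕtoℚ n
  ℕtoℚ-suc n = ℚP.toℚᵘ-injective (begin
      toℚᵘ (ℕtoℚ (suc n))        ≈⟨ ℚP.toℚᵘ-fromℚᵘ (mkℚᵘ (+ suc n) 0) ⟩
      mkℚᵘ (+ suc n) 0           ≈⟨ *≡* (cross-multiplied n) ⟩
      toℚᵘ 1ℚ ℚᵘ.+ mkℚᵘ (+ n) 0  ≈⟨ ℚᵘP.+-congʳ (toℚᵘ 1ℚ) (ℚᵘP.≃-sym (ℚP.toℚᵘ-fromℚᵘ (mkℚᵘ (+ n) 0))) ⟩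
      toℚᵘ 1ℚ ℚᵘ.+ toℚᵘ (ℕtoℚ n) ≈⟨ ℚᵘP.≃-sym (ℚP.toℚᵘ-homo-+ 1ℚ (ℕtoℚ n)) ⟩
      toℚᵘ (1ℚ + ℕtoℚ n)         ∎)
    where
    cross-multiplied : ∀ n → + suc n ℤ.* ℚᵘ.↧ (toℚᵘ 1ℚ ℚᵘ.+ mkℚᵘ (+ n) 0)
                           ≡ ℚᵘ.↥ (toℚᵘ 1ℚ ℚᵘ.+ mkℚᵘ (+ n) 0) ℤ.* + 1
    cross-multiplied zero    = refl
    cross-multiplied (suc k) = cong (λ z → + suc (suc z)) (sym (ℕP.*-identityʳ (k ℕ.* 1)))

  ℕtoℚ-+ : ∀ x y → ℕtoℚ (x ℕ.+ y) ≡ ℕtoℚ x + ℕtoℚ y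
  ℕtoℚ-+ zero    y = sym (ℚP.+-identityˡ (ℕtoℚ y))
  ℕtoℚ-+ (suc x) y = ≡.begin
      ℕtoℚ (suc (x ℕ.+ y))         ≡.≡⟨ ℕtoℚ-suc (x ℕ.+ y) ⟩
      1ℚ + ℕtoℚ (x ℕ.+ y)          ≡.≡⟨ cong (λ z → 1ℚ + z) (ℕtoℚ-+ x y) ⟩
      1ℚ + (ℕtoℚ x + ℕtoℚ y)       ≡.≡⟨ sym (ℚP.+-assoc 1ℚ (ℕtoℚ x) (ℕtoℚ y)) ⟩
      (1ℚ + ℕtoℚ x) + ℕtoℚ y       ≡.≡⟨ cong (_+ ℕtoℚ y) (sym (ℕtoℚ-suc x)) ⟩
      ℕtoℚ (suc x) + ℕtoℚ y        ≡.∎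
    where module ≡ = ≡-Reasoning

  //-*-cancel : ∀ x d → ((+ x) // suc d) * ℕtoℚ (suc d) ≡ ℕtoℚ x
  //-*-cancel x d = ℚP.toℚᵘ-injective (begin
      toℚᵘ ((+ x / suc d) * ℕtoℚ (suc d))            ≈⟨ ℚP.toℚᵘ-homo-* (+ x / suc d) (ℕtoℚ (suc d)) ⟩
      toℚᵘ (+ x / suc d) ℚᵘ.* toℚᵘ (ℕtoℚ (suc d))    ≈⟨ ℚᵘP.*-cong (ℚP.toℚᵘ-fromℚᵘ (mkℚᵘ (+ x) d))
                                                                  (ℚP.toℚᵘ-fromℚᵘ (mkℚᵘ (+ suc d) 0)) ⟩
      mkℚᵘ (+ x) d ℚᵘ.* mkℚᵘ (+ suc d) 0             ≈⟨ *≡* (cross-multiplied x) ⟩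
      mkℚᵘ (+ x) 0                                   ≈⟨ ℚᵘP.≃-sym (ℚP.toℚᵘ-fromℚᵘ (mkℚᵘ (+ x) 0)) ⟩
      toℚᵘ (ℕtoℚ x)                                  ∎)
    where
    cross-multiplied : ∀ x → ℚᵘ.↥ (mkℚᵘ (+ x) d ℚᵘ.* mkℚᵘ (+ suc d) 0) ℤ.* + 1
                           ≡ + x ℤ.* ℚᵘ.↧ (mkℚᵘ (+ x) d ℚᵘ.* mkℚᵘ (+ suc d) 0)
    cross-multiplied zero    = refl
    cross-multiplied (suc k) = cong (λ z → + suc z) (identity d k)
      where
      identity : ∀ d k → (d ℕ.+ k ℕ.* suc d) ℕ.* 1 ≡ d ℕ.* 1 ℕ.+ k ℕ.* suc (d ℕ.* 1)
      identity = solve-∀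

module FiniteSums where

  open import Defs
  open import Data.Nat as ℕ using (zero; suc)
  open import Data.Fin as F using (Fin; toℕ)
  open import Data.Rational using (ℚ; 0ℚ; 1ℚ; _+_; _*_; _-_)
  import Data.Rational.Properties as ℚP
  open import Data.Rational.Solver using (module +-*-Solver)
  open import Data.Empty using (⊥-elim)
  open import Relation.Binary.PropositionalEquality
  open +-*-Solver
  open RationalEmbedding

  Σ-cong : ∀ n {f g : Fin n → ℚ} → (∀ k → f k ≡ g k) → Σ n f ≡ Σ n g
  Σ-cong zero    eq = refl
  Σ-cong (suc n) eq = cong₂ _+_ (eq F.zero) (Σ-cong n (λ k → eq (F.suc k)))

  Σ-zero : ∀ n → Σ n (λ _ → 0ℚ) ≡ 0ℚ
  Σ-zero zero    = refl
  Σ-zero (suc n) = cong (0ℚ +_) (Σ-zero n)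

  Σ-+ : ∀ n (f g : Fin n → ℚ) → Σ n (λ k → f k + g k) ≡ Σ n f + Σ n g
  Σ-+ zero    f g = refl
  Σ-+ (suc n) f g = trans (cong ((f F.zero + g F.zero) +_) (Σ-+ n (λ k → f (F.suc k)) (λ k → g (F.suc k))))
    (solve 4 (λ a b c d → (a :+ b) :+ (c :+ d) := (a :+ c) :+ (b :+ d)) refl
       (f F.zero) (g F.zero) (Σ n (λ k → f (F.suc k))) (Σ n (λ k → g (F.suc k))))

  Σ-- : ∀ n (f g : Fin n → ℚ) → Σ n (λ k → f k - g k) ≡ Σ n f - Σ n g
  Σ-- zero    f g = refl
  Σ-- (suc n) f g = trans (cong ((f F.zero - g F.zero) +_) (Σ-- n (λ k → f (F.suc k)) (λ k → g (F.suc k))))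
    (solve 4 (λ a b c d → (a :- b) :+ (c :- d) := (a :+ c) :- (b :+ d)) refl
       (f F.zero) (g F.zero) (Σ n (λ k → f (F.suc k))) (Σ n (λ k → g (F.suc k))))

  Σ-*ˡ : ∀ n c (f : Fin n → ℚ) → Σ n (λ k → c * f k) ≡ c * Σ n f
  Σ-*ˡ zero    c f = sym (ℚP.*-zeroʳ c)
  Σ-*ˡ (suc n) c f = trans (cong (c * f F.zero +_) (Σ-*ˡ n c (λ k → f (F.suc k))))
                           (sym (ℚP.*-distribˡ-+ c _ _))

  Σ-*ʳ : ∀ n c (f : Fin n → ℚ) → Σ n (λ k → f k * c) ≡ Σ n f * c
  Σ-*ʳ n c f = trans (Σ-cong n (λ k → ℚP.*-comm (f k) c)) (trans (Σ-*ˡ n c f) (ℚP.*-comm c _))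

  Σ-swap : ∀ n m (f : Fin n → Fin m → ℚ) →
           Σ n (λ k → Σ m (λ l → f k l)) ≡ Σ m (λ l → Σ n (λ k → f k l))
  Σ-swap zero    m f = sym (Σ-zero m)
  Σ-swap (suc n) m f = trans (cong (Σ m (f F.zero) +_) (Σ-swap n m (λ k → f (F.suc k))))
                             (sym (Σ-+ m (f F.zero) (λ l → Σ n (λ k → f (F.suc k) l))))

  Σ-const : ∀ n c → Σ n (λ _ → c) ≡ ℕtoℚ n * c
  Σ-const zero    c = sym (ℚP.*-zeroˡ c)
  Σ-const (suc n) c = trans (cong (c +_) (Σ-const n c))
    (trans (solve 2 (λ c x → c :+ x :* c := (con 1ℚ :+ x) :* c) refl c (ℕtoℚ n))
           (cong (_* c) (sym (ℕtoℚ-suc n))))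

  Σ-index-double : ∀ n → Σ n (λ k → ℕtoℚ (toℕ k)) + Σ n (λ k → ℕtoℚ (toℕ k)) ≡ ℕtoℚ n * ℕtoℚ n - ℕtoℚ n
  Σ-index-double zero    = refl
  Σ-index-double (suc n) = begin
      G (suc n) + G (suc n)                   ≡⟨ cong (λ g → g + g) G-suc ⟩  
      (x + G n) + (x + G n)                   ≡⟨ solve 2 (λ x g → (x :+ g) :+ (x :+ g) := (x :+ x) :+ (g :+ g)) refl x (G n) ⟩
      (x + x) + (G n + G n)                   ≡⟨ cong ((x + x) +_) (Σ-index-double n) ⟩
      (x + x) + (x * x - x)                   ≡⟨ solve 1 (λ x → (x :+ x) :+ (x :* x :- x)
                                                    := (con 1ℚ :+ x) :* (con 1ℚ :+ x) :- (con 1ℚ :+ x)) refl x ⟩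
      (1ℚ + x) * (1ℚ + x) - (1ℚ + x)         ≡⟨ cong (λ y → y * y - y) (sym (ℕtoℚ-suc n)) ⟩
      ℕtoℚ (suc n) * ℕtoℚ (suc n) - ℕtoℚ (suc n) ∎
    where
    open ≡-Reasoning
    x = ℕtoℚ n
    G : ℕ → ℚ
    G t = Σ t (λ k → ℕtoℚ (toℕ k))
    -- shifting the index adds 1 to each of the n terms
    G-suc : G (suc n) ≡ x + G n
    G-suc = trans (ℚP.+-identityˡ _) (trans (Σ-cong n (λ k → ℕtoℚ-suc (toℕ k)))
              (trans (Σ-+ n (λ _ → 1ℚ) (λ k → ℕtoℚ (toℕ k)))
                     (cong (_+ G n) (trans (Σ-const n 1ℚ) (ℚP.*-identityʳ x)))))

  δ : ℕ → ℕ → ℚ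
  δ zero    zero    = 1ℚ
  δ zero    (suc b) = 0ℚ
  δ (suc a) zero    = 0ℚ
  δ (suc a) (suc b) = δ a b

  δ-≡ : ∀ {a b} → a ≡ b → δ a b ≡ 1ℚ
  δ-≡ {zero}  refl = refl
  δ-≡ {suc a} refl = δ-≡ {a} refl

  δ-≢ : ∀ {a b} → a ≢ b → δ a b ≡ 0ℚ
  δ-≢ {zero}  {zero}  a≢b = ⊥-elim (a≢b refl)
  δ-≢ {zero}  {suc b} a≢b = refl
  δ-≢ {suc a} {zero}  a≢b = refl
  δ-≢ {suc a} {suc b} a≢b = δ-≢ (λ a≡b → a≢b (cong suc a≡b))

  δ-sym : ∀ a b → δ a b ≡ δ b a
  δ-sym zero    zero    = refl
  δ-sym zero    (suc b) = refl
  δ-sym (suc a) zero    = refl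
  δ-sym (suc a) (suc b) = δ-sym a b

  Σ-δ : ∀ n (p : Fin n) (h : Fin n → ℚ) → Σ n (λ k → δ (toℕ k) (toℕ p) * h k) ≡ h p
  Σ-δ (suc n) F.zero    h = trans (cong (1ℚ * h F.zero +_) others-vanish)
                                  (trans (ℚP.+-identityʳ _) (ℚP.*-identityˡ _))
    where
    others-vanish : Σ n (λ k → 0ℚ * h (F.suc k)) ≡ 0ℚ
    others-vanish = trans (Σ-cong n (λ k → ℚP.*-zeroˡ (h (F.suc k)))) (Σ-zero n)
  Σ-δ (suc n) (F.suc p) h = trans (cong (_+ Σ n (λ k → δ (toℕ k) (toℕ p) * h (F.suc k))) (ℚP.*-zeroˡ (h F.zero)))
                                  (trans (ℚP.+-identityˡ _) (Σ-δ n p (λ k → h (F.suc k))))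

module Matrices (N : ℕ) where

  open import Defs
  open import Data.Rational using (_*_)
  import Data.Rational.Properties as ℚP
  open import Data.Product using (_,_)
  open import Relation.Binary.Bundles using (Setoid)
  import Relation.Binary.Reasoning.Setoid as SetoidReasoning
  open import Relation.Binary.PropositionalEquality
  open FiniteSums

  _≈_ : Matrix N → Matrix N → Set
  P ≈ Q = ∀ i j → P i j ≡ Q i j

  infix 4 _≈_

  ≈-setoid : Setoid _ _
  ≈-setoid = record
    { Carrier       = Matrix N
    ; _≈_           = _≈_
    ; isEquivalence = record
      { refl  = λ i j → refl
      ; sym   = λ P≈Q i j → sym (P≈Q i j)
      ; trans = λ P≈Q Q≈R i j → trans (P≈Q i j) (Q≈R i j)
      }
    }

  open Setoid ≈-setoid using () renaming (refl to ≈-refl; sym to ≈-sym)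

  ⊗-cong : ∀ {P P′ Q Q′} → P ≈ P′ → Q ≈ Q′ → P ⊗ Q ≈ P′ ⊗ Q′
  ⊗-cong P≈P′ Q≈Q′ i j = Σ-cong N (λ k → cong₂ _*_ (P≈P′ i k) (Q≈Q′ k j))

  ⊗-congˡ : ∀ P {Q Q′} → Q ≈ Q′ → P ⊗ Q ≈ P ⊗ Q′
  ⊗-congˡ P = ⊗-cong (≈-refl {P})

  ⊗-congʳ : ∀ {P P′} Q → P ≈ P′ → P ⊗ Q ≈ P′ ⊗ Q
  ⊗-congʳ Q P≈P′ = ⊗-cong P≈P′ (≈-refl {Q})

  ᵀ-cong : ∀ {P Q} → P ≈ Q → transpose P ≈ transpose Q
  ᵀ-cong P≈Q i j = P≈Q j i

  ⊗-assoc : ∀ P Q R → (P ⊗ Q) ⊗ R ≈ P ⊗ (Q ⊗ R)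
  ⊗-assoc P Q R i j = begin
      Σ N (λ k → Σ N (λ l → P i l * Q l k) * R k j)   ≡⟨ Σ-cong N (λ k → sym (Σ-*ʳ N (R k j) (λ l → P i l * Q l k))) ⟩
      Σ N (λ k → Σ N (λ l → P i l * Q l k * R k j))   ≡⟨ Σ-swap N N _ ⟩
      Σ N (λ l → Σ N (λ k → P i l * Q l k * R k j))   ≡⟨ Σ-cong N (λ l → Σ-cong N (λ k → ℚP.*-assoc (P i l) (Q l k) (R k j))) ⟩
      Σ N (λ l → Σ N (λ k → P i l * (Q l k * R k j))) ≡⟨ Σ-cong N (λ l → Σ-*ˡ N (P i l) (λ k → Q l k * R k j)) ⟩
      Σ N (λ l → P i l * Σ N (λ k → Q l k * R k j))   ∎
    where open ≡-Reasoning

  ᵀ-⊗ : ∀ P Q → transpose (P ⊗ Q) ≈ transpose Q ⊗ transpose P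
  ᵀ-⊗ P Q i j = Σ-cong N (λ k → ℚP.*-comm (P j k) (Q k i))

  -- The two halves of the classical uniqueness argument for the Moore–Penrose
  -- inverse: for pseudoinverses X and Y of A, both X and Y equal X ⊗ (A ⊗ Y).
  module _ {A X Y : Matrix N} where

    open SetoidReasoning ≈-setoid
    private
      ᵀ : Matrix N → Matrix N
      ᵀ = transpose

    pinv-left : IsPseudoinverse A X → IsPseudoinverse A Y → X ≈ X ⊗ (A ⊗ Y)
    pinv-left (_ , XAX , AXᵀ , _) (AYA , _ , AYᵀ , _) = begin
      X                                ≈⟨ ≈-sym XAX ⟩
      (X ⊗ A) ⊗ X                      ≈⟨ ⊗-assoc X A X ⟩
      X ⊗ (A ⊗ X)                      ≈⟨ ⊗-congˡ X (≈-sym AXᵀ) ⟩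
      X ⊗ ᵀ (A ⊗ X)                    ≈⟨ ⊗-congˡ X (ᵀ-⊗ A X) ⟩
      X ⊗ (ᵀ X ⊗ ᵀ A)                  ≈⟨ ⊗-congˡ X (⊗-congˡ (ᵀ X) (ᵀ-cong (≈-sym AYA))) ⟩
      X ⊗ (ᵀ X ⊗ ᵀ ((A ⊗ Y) ⊗ A))      ≈⟨ ⊗-congˡ X (⊗-congˡ (ᵀ X) (ᵀ-⊗ (A ⊗ Y) A)) ⟩
      X ⊗ (ᵀ X ⊗ (ᵀ A ⊗ ᵀ (A ⊗ Y)))    ≈⟨ ⊗-congˡ X (⊗-congˡ (ᵀ X) (⊗-congˡ (ᵀ A) AYᵀ)) ⟩
      X ⊗ (ᵀ X ⊗ (ᵀ A ⊗ (A ⊗ Y)))      ≈⟨ ⊗-congˡ X (≈-sym (⊗-assoc (ᵀ X) (ᵀ A) (A ⊗ Y))) ⟩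
      X ⊗ ((ᵀ X ⊗ ᵀ A) ⊗ (A ⊗ Y))      ≈⟨ ⊗-congˡ X (⊗-congʳ (A ⊗ Y) (≈-sym (ᵀ-⊗ A X))) ⟩
      X ⊗ (ᵀ (A ⊗ X) ⊗ (A ⊗ Y))        ≈⟨ ⊗-congˡ X (⊗-congʳ (A ⊗ Y) AXᵀ) ⟩
      X ⊗ ((A ⊗ X) ⊗ (A ⊗ Y))          ≈⟨ ≈-sym (⊗-assoc X (A ⊗ X) (A ⊗ Y)) ⟩
      (X ⊗ (A ⊗ X)) ⊗ (A ⊗ Y)          ≈⟨ ⊗-congʳ (A ⊗ Y) (≈-sym (⊗-assoc X A X)) ⟩
      ((X ⊗ A) ⊗ X) ⊗ (A ⊗ Y)          ≈⟨ ⊗-congʳ (A ⊗ Y) XAX ⟩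
      X ⊗ (A ⊗ Y)                      ∎

    -- Aᵀ = (X ⊗ A) ⊗ Aᵀ, the transpose of A = A ⊗ (X ⊗ A).
    ᵀ-absorbs : IsPseudoinverse A X → ᵀ A ≈ (X ⊗ A) ⊗ ᵀ A
    ᵀ-absorbs (AXA , _ , _ , XAᵀ) = begin
      ᵀ A                  ≈⟨ ᵀ-cong (≈-sym AXA) ⟩
      ᵀ ((A ⊗ X) ⊗ A)      ≈⟨ ᵀ-cong (⊗-assoc A X A) ⟩
      ᵀ (A ⊗ (X ⊗ A))      ≈⟨ ᵀ-⊗ A (X ⊗ A) ⟩
      ᵀ (X ⊗ A) ⊗ ᵀ A      ≈⟨ ⊗-congʳ (ᵀ A) XAᵀ ⟩
      (X ⊗ A) ⊗ ᵀ A        ∎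

    pinv-right : IsPseudoinverse A X → IsPseudoinverse A Y → Y ≈ X ⊗ (A ⊗ Y)
    pinv-right X⁺ (_ , YAY , _ , YAᵀ) = begin
      Y                                  ≈⟨ ≈-sym YAY ⟩
      (Y ⊗ A) ⊗ Y                        ≈⟨ ⊗-congʳ Y (≈-sym YAᵀ) ⟩
      ᵀ (Y ⊗ A) ⊗ Y                      ≈⟨ ⊗-congʳ Y (ᵀ-⊗ Y A) ⟩
      (ᵀ A ⊗ ᵀ Y) ⊗ Y                    ≈⟨ ⊗-congʳ Y (⊗-congʳ (ᵀ Y) (ᵀ-absorbs X⁺)) ⟩
      (((X ⊗ A) ⊗ ᵀ A) ⊗ ᵀ Y) ⊗ Y        ≈⟨ ⊗-congʳ Y (⊗-assoc (X ⊗ A) (ᵀ A) (ᵀ Y)) ⟩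
      ((X ⊗ A) ⊗ (ᵀ A ⊗ ᵀ Y)) ⊗ Y        ≈⟨ ⊗-congʳ Y (⊗-congˡ (X ⊗ A) (≈-sym (ᵀ-⊗ Y A))) ⟩
      ((X ⊗ A) ⊗ ᵀ (Y ⊗ A)) ⊗ Y          ≈⟨ ⊗-congʳ Y (⊗-congˡ (X ⊗ A) YAᵀ) ⟩
      ((X ⊗ A) ⊗ (Y ⊗ A)) ⊗ Y            ≈⟨ ⊗-assoc (X ⊗ A) (Y ⊗ A) Y ⟩
      (X ⊗ A) ⊗ ((Y ⊗ A) ⊗ Y)            ≈⟨ ⊗-congˡ (X ⊗ A) YAY ⟩
      (X ⊗ A) ⊗ Y                        ≈⟨ ⊗-assoc X A Y ⟩
      X ⊗ (A ⊗ Y)                        ∎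

  pinv-unique : ∀ {A X Y} → IsPseudoinverse A X → IsPseudoinverse A Y → X ≈ Y
  pinv-unique X⁺ Y⁺ i j = trans (pinv-left X⁺ Y⁺ i j) (sym (pinv-right X⁺ Y⁺ i j))

module CyclicOffset (m : ℕ) where

  open import Data.Nat as ℕ using (suc; _+_; _∸_; _%_; _<_; _≤?_; _<?_; z≤n; s≤s)
  open import Data.Nat.Properties
  open import Data.Nat.DivMod using ([m+n]%n≡m%n; m<n⇒m%n≡m)
  open import Data.Fin as F using (Fin; toℕ)
  open import Data.Fin.Properties using (toℕ-fromℕ<; toℕ-inject₁; toℕ-fromℕ; toℕ<n; toℕ-injective)
  open import Data.Product using (_×_; _,_; proj₁; ∃)
  open import Data.Sum using (_⊎_; inj₁; inj₂)
  open import Data.Empty using (⊥-elim)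
  open import Relation.Nullary using (yes; no)
  open import Relation.Binary.PropositionalEquality

  N : ℕ
  N = suc m

  offset : ℕ → ℕ → ℕ
  offset i j = (j + N ∸ i) % N

  -- x is an offset from i to j: stepping x times from i reaches j, possibly
  -- wrapping around once.
  Reaches : ℕ → ℕ → ℕ → Set
  Reaches i j x = x + i ≡ j ⊎ x + i ≡ j + N

  IsOffset : ℕ → ℕ → ℕ → Set
  IsOffset i j x = x < N × Reaches i j x

  offset-isOffset : ∀ {i j} → i < N → j < N → IsOffset i j (offset i j)
  offset-isOffset {i} {j} i<N j<N with i ≤? j
  ... | yes i≤j = subst (IsOffset i j) (sym offset≡) (≤-<-trans (m∸n≤m j i) j<N , inj₁ (m∸n+n≡m i≤j))
    where
    offset≡ : offset i j ≡ j ∸ i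
    offset≡ = trans (cong (_% N) (+-∸-comm N i≤j))
                (trans ([m+n]%n≡m%n (j ∸ i) N) (m<n⇒m%n≡m (≤-<-trans (m∸n≤m j i) j<N)))
  ... | no i≰j = subst (IsOffset i j) (sym (m<n⇒m%n≡m wrapped<N)) (wrapped<N , inj₂ (m∸n+n≡m i≤j+N))
    where
    i≤j+N : i ≤ j + N
    i≤j+N = ≤-trans (<⇒≤ i<N) (m≤n+m N j)
    wrapped<N : j + N ∸ i < N
    wrapped<N = subst (j + N ∸ i <_) (m+n∸m≡n i N) (∸-monoˡ-< (+-monoˡ-< N (≰⇒> i≰j)) i≤j+N)

  wrap-apart : ∀ {i j x y} → x + i ≡ j → y + i ≡ j + N → y ≡ x + N
  wrap-apart {i} {j} {x} {y} x+i≡j y+i≡j+N = +-cancelʳ-≡ i y (x + N) (begin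
      y + i        ≡⟨ y+i≡j+N ⟩
      j + N        ≡⟨ cong (_+ N) (sym x+i≡j) ⟩
      x + i + N    ≡⟨ +-assoc x i N ⟩
      x + (i + N)  ≡⟨ cong (x +_) (+-comm i N) ⟩
      x + (N + i)  ≡⟨ sym (+-assoc x N i) ⟩
      x + N + i    ∎)
    where open ≡-Reasoning

  -- Offsets are unique: two solutions below N cannot differ by N.
  isOffset-unique : ∀ {i j x y} → IsOffset i j x → IsOffset i j y → x ≡ y
  isOffset-unique {i} {j} {x} {y} (_ , inj₁ a) (_ , inj₁ b) = +-cancelʳ-≡ i x y (trans a (sym b))
  isOffset-unique {i} {j} {x} {y} (_ , inj₂ a) (_ , inj₂ b) = +-cancelʳ-≡ i x y (trans a (sym b))
  isOffset-unique {i} {j} {x} {y} (_ , inj₁ a) (y<N , inj₂ b) =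
    ⊥-elim (m+n≮n x N (subst (_< N) (wrap-apart a b) y<N))
  isOffset-unique {i} {j} {x} {y} (x<N , inj₂ a) (_ , inj₁ b) =
    ⊥-elim (m+n≮n y N (subst (_< N) (wrap-apart b a) x<N))

  offset-char : ∀ {i j x} → i < N → j < N → IsOffset i j x → offset i j ≡ x
  offset-char i<N j<N = isOffset-unique (offset-isOffset i<N j<N)

  reaches-below : ∀ {i j z} → i < N → j < N → j ≢ i → Reaches i j z → z ≤ N → z < N
  reaches-below {i} {j} {z} i<N j<N j≢i reaches z≤N with z ℕ.≟ N
  ... | no z≢N = ≤∧≢⇒< z≤N z≢N
  ... | yes refl with reaches
  ...   | inj₁ N+i≡j   = ⊥-elim (<⇒≱ j<N (subst (N ≤_) N+i≡j (m≤m+n N i)))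
  ...   | inj₂ N+i≡j+N = ⊥-elim (j≢i (sym (+-cancelˡ-≡ N i j (trans N+i≡j+N (+-comm j N)))))

  next : Fin N → Fin N
  next i with suc (toℕ i) <? N
  ... | yes i+1<N = F.fromℕ< i+1<N
  ... | no _      = F.zero

  next-spec : ∀ i → (suc (toℕ i) < N × toℕ (next i) ≡ suc (toℕ i)) ⊎ (suc (toℕ i) ≡ N × toℕ (next i) ≡ 0)
  next-spec i with suc (toℕ i) <? N
  ... | yes i+1<N = inj₁ (i+1<N , toℕ-fromℕ< i+1<N)
  ... | no i+1≮N  = inj₂ (≤∧≮⇒≡ (toℕ<n i) i+1≮N , refl)

  next-fromℕ< : ∀ {t} (t<N : t < N) (t+1<N : suc t < N) → next (F.fromℕ< t<N) ≡ F.fromℕ< t+1<N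
  next-fromℕ< {t} t<N t+1<N with next-spec (F.fromℕ< t<N)
  ... | inj₁ (_ , next≡) = toℕ-injective (begin
      toℕ (next (F.fromℕ< t<N))  ≡⟨ next≡ ⟩
      suc (toℕ (F.fromℕ< t<N))   ≡⟨ cong suc (toℕ-fromℕ< t<N) ⟩
      suc t                      ≡⟨ sym (toℕ-fromℕ< t+1<N) ⟩
      toℕ (F.fromℕ< t+1<N)       ∎)
    where open ≡-Reasoning
  ... | inj₂ (wraps , _) = ⊥-elim (<⇒≢ t+1<N (trans (cong suc (sym (toℕ-fromℕ< t<N))) wraps))

  prev : Fin N → Fin N
  prev F.zero    = F.fromℕ m
  prev (F.suc j) = F.inject₁ j

  prev-spec : ∀ j → (∃ λ j′ → toℕ j ≡ suc j′ × toℕ (prev j) ≡ j′) ⊎ (toℕ j ≡ 0 × toℕ (prev j) ≡ m)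
  prev-spec F.zero    = inj₂ (refl , toℕ-fromℕ m)
  prev-spec (F.suc j) = inj₁ (toℕ j , refl , toℕ-inject₁ j)

  next≢ : 1 ≤ m → ∀ i → toℕ (next i) ≢ toℕ i
  next≢ 1≤m i with next-spec i
  ... | inj₁ (_ , next≡)     = λ eq → <⇒≢ (n<1+n (toℕ i)) (sym (trans (sym next≡) eq))
  ... | inj₂ (wraps , next≡) = λ eq → <⇒≢ (s≤s 1≤m) (trans (sym (cong suc (trans (sym eq) next≡))) wraps)

  prev≢ : 1 ≤ m → ∀ j → toℕ (prev j) ≢ toℕ j
  prev≢ 1≤m j with prev-spec j
  ... | inj₁ (j′ , j≡ , prev≡) = λ eq → <⇒≢ (n<1+n j′) (trans (sym prev≡) (trans eq j≡))
  ... | inj₂ (j≡ , prev≡)      = λ eq → <⇒≢ 1≤m (sym (trans (sym prev≡) (trans eq j≡)))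

  Δ : Fin N → Fin N → ℕ
  Δ i j = offset (toℕ i) (toℕ j)

  Δ-self : ∀ i → Δ i i ≡ 0
  Δ-self i = offset-char (toℕ<n i) (toℕ<n i) (s≤s z≤n , inj₁ refl)

  Δ≡0⇒≡ : ∀ i j → Δ i j ≡ 0 → toℕ i ≡ toℕ j
  Δ≡0⇒≡ i j Δ≡0 with offset-isOffset (toℕ<n i) (toℕ<n j)
  ... | _ , inj₁ reach = trans (sym (cong (_+ toℕ i) Δ≡0)) reach
  ... | _ , inj₂ reach = ⊥-elim (<⇒≱ (toℕ<n i)
          (subst (N ≤_) (sym (trans (sym (cong (_+ toℕ i) Δ≡0)) reach)) (m≤n+m N (toℕ j))))

  Δ-forward : ∀ i j → toℕ i ≤ toℕ j → Δ i j ≡ toℕ j ∸ toℕ i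
  Δ-forward i j i≤j = offset-char (toℕ<n i) (toℕ<n j)
    (≤-<-trans (m∸n≤m (toℕ j) (toℕ i)) (toℕ<n j) , inj₁ (m∸n+n≡m i≤j))

  Δ-backward : ∀ i j → toℕ j < toℕ i → Δ i j + toℕ i ≡ toℕ j + N
  Δ-backward i j j<i with offset-isOffset (toℕ<n i) (toℕ<n j)
  ... | _ , inj₁ reach = ⊥-elim (<⇒≱ j<i (≤-trans (m≤n+m (toℕ i) (Δ i j)) (≤-reflexive reach)))
  ... | _ , inj₂ reach = reach

  Δ-next : ∀ i j → toℕ j ≢ toℕ i → Δ i j ≡ suc (Δ (next i) j)
  Δ-next i j j≢i = offset-char (toℕ<n i) (toℕ<n j)
      (reaches-below (toℕ<n i) (toℕ<n j) j≢i reaches (proj₁ (offset-isOffset (toℕ<n (next i)) (toℕ<n j))) , reaches)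
    where
    y = Δ (next i) j
    reaches : Reaches (toℕ i) (toℕ j) (suc y)
    reaches with next-spec i | offset-isOffset (toℕ<n (next i)) (toℕ<n j)
    ... | inj₁ (_ , next≡) | _ , inj₁ r = inj₁ (trans (sym (+-suc y (toℕ i))) (trans (cong (y +_) (sym next≡)) r))
    ... | inj₁ (_ , next≡) | _ , inj₂ r = inj₂ (trans (sym (+-suc y (toℕ i))) (trans (cong (y +_) (sym next≡)) r))
    ... | inj₂ (wraps , next≡) | _ , inj₁ r = inj₂ (trans (sym (+-suc y (toℕ i))) (trans (cong (y +_) wraps)
            (cong (_+ N) (trans (sym (+-identityʳ y)) (trans (cong (y +_) (sym next≡)) r)))))
    ... | inj₂ (wraps , next≡) | y<N , inj₂ r = ⊥-elim (<⇒≱ y<N (subst (N ≤_)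
            (sym (trans (sym (+-identityʳ y)) (trans (cong (y +_) (sym next≡)) r))) (m≤n+m N (toℕ j))))

  Δ-next-self : ∀ i → Δ (next i) i ≡ m
  Δ-next-self i = offset-char (toℕ<n (next i)) (toℕ<n i) (n<1+n m , reaches)
    where
    reaches : Reaches (toℕ (next i)) (toℕ i) m
    reaches with next-spec i
    ... | inj₁ (_ , next≡)     = inj₂ (trans (cong (m +_) next≡) (trans (+-suc m (toℕ i)) (+-comm N (toℕ i))))
    ... | inj₂ (wraps , next≡) = inj₁ (trans (cong (m +_) next≡) (trans (+-identityʳ m) (suc-injective (sym wraps))))

  Δ-prev : ∀ i j → toℕ j ≢ toℕ i → Δ i j ≡ suc (Δ i (prev j))
  Δ-prev i j j≢i = offset-char (toℕ<n i) (toℕ<n j)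
      (reaches-below (toℕ<n i) (toℕ<n j) j≢i reaches (proj₁ (offset-isOffset (toℕ<n i) (toℕ<n (prev j)))) , reaches)
    where
    y = Δ i (prev j)
    reaches : Reaches (toℕ i) (toℕ j) (suc y)
    reaches with prev-spec j | offset-isOffset (toℕ<n i) (toℕ<n (prev j))
    ... | inj₁ (_ , j≡ , prev≡) | _ , inj₁ r = inj₁ (trans (cong suc (trans r prev≡)) (sym j≡))
    ... | inj₁ (_ , j≡ , prev≡) | _ , inj₂ r = inj₂ (trans (cong suc (trans r (cong (_+ N) prev≡))) (cong (_+ N) (sym j≡)))
    ... | inj₂ (j≡ , prev≡)     | _ , inj₁ r = inj₂ (trans (cong suc (trans r prev≡)) (cong (_+ N) (sym j≡)))
    ... | inj₂ (j≡ , prev≡)     | y<N , inj₂ r = ⊥-elim (<⇒≱ too-small (≤-reflexive (sym (trans r (cong (_+ N) prev≡)))))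
      where
      too-small : y + toℕ i < m + N
      too-small = +-mono-≤-< (ℕ.s≤s⁻¹ y<N) (toℕ<n i)

  Δ-prev-self : ∀ i → Δ i (prev i) ≡ m
  Δ-prev-self i = offset-char (toℕ<n i) (toℕ<n (prev i)) (n<1+n m , reaches)
    where
    reaches : Reaches (toℕ i) (toℕ (prev i)) m
    reaches with prev-spec i
    ... | inj₁ (i′ , i≡ , prev≡) = inj₂ (trans (cong (m +_) i≡) (trans (+-suc m i′) (trans (+-comm N i′) (cong (_+ N) (sym prev≡)))))
    ... | inj₂ (i≡ , prev≡)      = inj₁ (trans (cong (m +_) i≡) (trans (+-identityʳ m) (sym prev≡)))

module PiecewisePolynomials where

  open import Defs
  open import Data.Fin using (Fin)
  open import Data.Rational using (ℚ)
  open import Relation.Binary.PropositionalEquality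

  pieces-cong : ∀ {D N a b} {p q : Fin N → ℚ} → (∀ i → p i ≡ q i) → Pieces D q a b → Pieces D p a b
  pieces-cong p≗q done                     = done
  pieces-cong p≗q (seg a<c cs agrees rest) =
    seg a<c cs (λ i a≤i i<c → trans (p≗q i) (agrees i a≤i i<c)) (pieces-cong p≗q rest)

module Profile (m : ℕ) where

  open import Defs
  open import Data.Nat as ℕ using (suc; _∸_; _<_; z≤n; s≤s)
  open import Data.Fin as F using (toℕ)
  open import Data.Fin.Properties using (toℕ<n)
  open import Data.Integer using (+_)
  open import Data.Rational using (ℚ; 0ℚ; 1ℚ; _+_; _*_; _-_)
  import Data.Rational.Properties as ℚP
  open import Data.Rational.Solver using (module +-*-Solver)
  open import Data.Vec using (Vec; []; _∷_)
  open import Relation.Nullary using (yes; no)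
  open import Relation.Binary.PropositionalEquality
  import Data.Nat.Properties as ℕP
  open +-*-Solver
  open RationalEmbedding
  open CyclicOffset m

  invN : ℚ
  invN = (+ 1) // N

  invN-inverse : invN * ℕtoℚ N ≡ 1ℚ
  invN-inverse = //-*-cancel 1 m

  //N : ∀ x → (+ x) // N ≡ ℕtoℚ x * invN
  //N x = begin
      (+ x) // N                          ≡⟨ sym (ℚP.*-identityʳ _) ⟩
      (+ x) // N * 1ℚ                     ≡⟨ cong ((+ x) // N *_) (sym (trans (ℚP.*-comm _ invN) invN-inverse)) ⟩
      (+ x) // N * (ℕtoℚ N * invN)        ≡⟨ sym (ℚP.*-assoc ((+ x) // N) (ℕtoℚ N) invN) ⟩
      (+ x) // N * ℕtoℚ N * invN          ≡⟨ cong (_* invN) (//-*-cancel x m) ⟩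
      ℕtoℚ x * invN                       ∎
    where open ≡-Reasoning

  c₀ : ℚ
  c₀ = (+ (N ∸ 1)) // (2 ℕ.* N)

  c₀-double : c₀ + c₀ ≡ ℕtoℚ m * invN
  c₀-double = begin
      c₀ + c₀                               ≡⟨ sym (trans (cong ((c₀ + c₀) *_) (trans (ℚP.*-comm _ invN) invN-inverse))
                                                         (ℚP.*-identityʳ _)) ⟩
      (c₀ + c₀) * (ℕtoℚ N * invN)           ≡⟨ solve 3 (λ c n ι → (c :+ c) :* (n :* ι) := (c :* (n :+ (n :+ con 0ℚ))) :* ι)
                                                  refl c₀ (ℕtoℚ N) invN ⟩
      (c₀ * (ℕtoℚ N + (ℕtoℚ N + 0ℚ))) * invN ≡⟨ cong (λ z → (c₀ * z) * invN)
                                                  (sym (trans (ℕtoℚ-+ N (N ℕ.+ 0)) (cong (λ z → ℕtoℚ N + z) (ℕtoℚ-+ N 0)))) ⟩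
      (c₀ * ℕtoℚ (2 ℕ.* N)) * invN           ≡⟨ cong (_* invN) (//-*-cancel m _) ⟩
      ℕtoℚ m * invN                         ∎
    where open ≡-Reasoning

  profile : ℕ → ℚ
  profile x = c₀ - (+ x) // N

  profile-linear : ∀ x → profile x ≡ c₀ - ℕtoℚ x * invN
  profile-linear x = cong (c₀ -_) (//N x)

  profile-step : ∀ y → profile (suc y) - profile y ≡ 0ℚ - invN
  profile-step y = begin
      profile (suc y) - profile y                       ≡⟨ cong₂ _-_ (profile-linear (suc y)) (profile-linear y) ⟩
      (c₀ - ℕtoℚ (suc y) * invN) - (c₀ - ℕtoℚ y * invN)  ≡⟨ cong (λ z → (c₀ - z * invN) - (c₀ - ℕtoℚ y * invN)) (ℕtoℚ-suc y) ⟩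
      (c₀ - (1ℚ + ℕtoℚ y) * invN) - (c₀ - ℕtoℚ y * invN) ≡⟨ solve 3 (λ c y ι → (c :- (con 1ℚ :+ y) :* ι) :- (c :- y :* ι) := con 0ℚ :- ι)
                                                             refl c₀ (ℕtoℚ y) invN ⟩
      0ℚ - invN                                         ∎
    where open ≡-Reasoning

  profile-wrap : profile 0 - profile m ≡ 1ℚ - invN
  profile-wrap = begin
      profile 0 - profile m                          ≡⟨ cong₂ _-_ (profile-linear 0) (profile-linear m) ⟩
      (c₀ - 0ℚ * invN) - (c₀ - ℕtoℚ m * invN)        ≡⟨ solve 3 (λ c y ι → (c :- con 0ℚ :* ι) :- (c :- y :* ι) := (con 1ℚ :+ y) :* ι :- ι)
                                                          refl c₀ (ℕtoℚ m) invN ⟩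
      (1ℚ + ℕtoℚ m) * invN - invN                    ≡⟨ cong (λ z → z * invN - invN) (sym (ℕtoℚ-suc m)) ⟩
      ℕtoℚ N * invN - invN                           ≡⟨ cong (_- invN) (trans (ℚP.*-comm (ℕtoℚ N) invN) invN-inverse) ⟩
      1ℚ - invN                                      ∎
    where open ≡-Reasoning

  S⁺ : Matrix N
  S⁺ i j = profile (Δ i j)

  S⁺-above : ∀ i j → toℕ i ≤ toℕ j → S⁺ i j ≡ c₀ - (+ (toℕ j ∸ toℕ i)) // N
  S⁺-above i j i≤j = cong profile (Δ-forward i j i≤j)

  -- On either side of the diagonal S⁺ is one affine expression in i and j:
  -- x + i ≡ j + e (e = 0 above, e = N below) forces x = j + e − i.
  affine : ℕ → ℕ → ℕ → ℚ
  affine e i j = c₀ - (ℕtoℚ j + ℕtoℚ e - ℕtoℚ i) * invN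

  profile-affine : ∀ x i j e → x ℕ.+ i ≡ j ℕ.+ e → profile x ≡ affine e i j
  profile-affine x i j e x+i≡j+e = trans (profile-linear x) (cong (λ z → c₀ - z * invN) x≡)
    where
    x≡ : ℕtoℚ x ≡ ℕtoℚ j + ℕtoℚ e - ℕtoℚ i
    x≡ = begin
      ℕtoℚ x                              ≡⟨ solve 2 (λ x i → x := (x :+ i) :- i) refl (ℕtoℚ x) (ℕtoℚ i) ⟩
      (ℕtoℚ x + ℕtoℚ i) - ℕtoℚ i           ≡⟨ cong (_- ℕtoℚ i) (sym (ℕtoℚ-+ x i)) ⟩
      ℕtoℚ (x ℕ.+ i) - ℕtoℚ i              ≡⟨ cong (λ z → ℕtoℚ z - ℕtoℚ i) x+i≡j+e ⟩
      ℕtoℚ (j ℕ.+ e) - ℕtoℚ i              ≡⟨ cong (_- ℕtoℚ i) (ℕtoℚ-+ j e) ⟩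
      ℕtoℚ j + ℕtoℚ e - ℕtoℚ i             ∎
      where open ≡-Reasoning

  S⁺-upper : ∀ i j → toℕ i ≤ toℕ j → S⁺ i j ≡ affine 0 (toℕ i) (toℕ j)
  S⁺-upper i j i≤j = profile-affine (Δ i j) (toℕ i) (toℕ j) 0 (begin
      Δ i j ℕ.+ toℕ i          ≡⟨ cong (ℕ._+ toℕ i) (Δ-forward i j i≤j) ⟩
      toℕ j ∸ toℕ i ℕ.+ toℕ i  ≡⟨ ℕP.m∸n+n≡m i≤j ⟩
      toℕ j                    ≡⟨ sym (ℕP.+-identityʳ (toℕ j)) ⟩
      toℕ j ℕ.+ 0              ∎)
    where open ≡-Reasoning

  S⁺-lower : ∀ i j → toℕ j < toℕ i → S⁺ i j ≡ affine N (toℕ i) (toℕ j)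
  S⁺-lower i j j<i = profile-affine (Δ i j) (toℕ i) (toℕ j) N (Δ-backward i j j<i)

  rowPoly : ℕ → ℕ → Vec ℚ 2
  rowPoly i e = (c₀ - (ℕtoℚ e - ℕtoℚ i) * invN) ∷ (0ℚ - invN) ∷ []

  colPoly : ℕ → ℕ → Vec ℚ 2
  colPoly j e = (c₀ - (ℕtoℚ j + ℕtoℚ e) * invN) ∷ invN ∷ []

  affine-in-j : ∀ e i j → affine e i j ≡ evalPoly (rowPoly i e) (ℕtoℚ j)
  affine-in-j e i j = solve 5 (λ c j e i ι → c :- (j :+ e :- i) :* ι
                                            := (c :- (e :- i) :* ι) :+ j :* ((con 0ℚ :- ι) :+ j :* con 0ℚ))
                              refl c₀ (ℕtoℚ j) (ℕtoℚ e) (ℕtoℚ i) invN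

  affine-in-i : ∀ e i j → affine e i j ≡ evalPoly (colPoly j e) (ℕtoℚ i)
  affine-in-i e i j = solve 5 (λ c j e i ι → c :- (j :+ e :- i) :* ι
                                            := (c :- (j :+ e) :* ι) :+ i :* (ι :+ i :* con 0ℚ))
                              refl c₀ (ℕtoℚ j) (ℕtoℚ e) (ℕtoℚ i) invN

  S⁺-rows-linear : ∀ i → PiecewiseLinear (λ j → S⁺ i j)
  S⁺-rows-linear F.zero =
    seg (s≤s z≤n) (rowPoly 0 0) (λ j _ _ → trans (S⁺-upper F.zero j z≤n) (affine-in-j 0 0 (toℕ j))) done
  S⁺-rows-linear i@(F.suc _) =
    seg (s≤s z≤n) (rowPoly (toℕ i) N)
        (λ j _ j<i → trans (S⁺-lower i j j<i) (affine-in-j N (toℕ i) (toℕ j)))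
    (seg (toℕ<n i) (rowPoly (toℕ i) 0)
        (λ j i≤j _ → trans (S⁺-upper i j i≤j) (affine-in-j 0 (toℕ i) (toℕ j)))
    done)

  S⁺-cols-linear : ∀ j → PiecewiseLinear (λ i → S⁺ i j)
  S⁺-cols-linear j with suc (toℕ j) ℕ.<? N
  ... | yes j+1<N =
    seg (s≤s z≤n) (colPoly (toℕ j) 0)
        (λ i _ i≤j → trans (S⁺-upper i j (ℕ.s≤s⁻¹ i≤j)) (affine-in-i 0 (toℕ i) (toℕ j)))
    (seg j+1<N (colPoly (toℕ j) N)
        (λ i j<i _ → trans (S⁺-lower i j j<i) (affine-in-i N (toℕ i) (toℕ j)))
    done)
  ... | no j+1≮N =
    seg (s≤s z≤n) (colPoly (toℕ j) 0)
        (λ i _ i<N → trans (S⁺-upper i j (ℕ.s≤s⁻¹ (ℕP.≤-trans i<N (last-column j+1≮N))))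
                           (affine-in-i 0 (toℕ i) (toℕ j)))
    done
    where
    last-column : suc (toℕ j) ℕ.≮ N → N ≤ suc (toℕ j)
    last-column j+1≮N = ℕP.≤-reflexive (sym (ℕP.≤∧≮⇒≡ (toℕ<n j) j+1≮N))

module Pseudoinverse (m : ℕ) (1≤m : 1 ≤ m) where

  open import Defs
  open import Data.Nat as ℕ using (suc; zero; _<_; z≤n)
  import Data.Nat.Properties as ℕP
  open import Data.Fin as F using (Fin; toℕ)
  open import Data.Fin.Properties using (toℕ<n; toℕ-injective; fromℕ<-toℕ)
  open import Data.Integer using (+_)
  open import Data.Rational using (ℚ; 0ℚ; 1ℚ; _+_; _*_; _-_; _/_)
  import Data.Rational.Properties as ℚP
  open import Data.Rational.Solver using (module +-*-Solver)
  open import Algebra.Properties.Group ℚP.+-0-group using (x∙y⁻¹≈ε⇒x≈y)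
  open import Data.Product using (_,_)
  open import Relation.Nullary using (yes; no)
  open import Relation.Binary.PropositionalEquality
  open +-*-Solver
  open RationalEmbedding
  open FiniteSums
  open CyclicOffset m
  open Profile m
  open Matrices N

  S : Matrix N
  S = S-C N

  S-rows : ∀ i k → S i k ≡ δ (toℕ k) (toℕ i) - δ (toℕ k) (toℕ (next i))
  S-rows i k with toℕ k ℕ.≟ toℕ i
  ... | yes k≡i = trans (cong cycleRow (trans (cong (offset (toℕ i)) k≡i) (Δ-self i)))
                    (sym (cong₂ _-_ (δ-≡ k≡i) (δ-≢ (λ k≡next → next≢ 1≤m i (trans (sym k≡next) k≡i)))))
  ... | no k≢i with Δ (next i) k in Δ≡
  ...   | zero  = trans (cong cycleRow (trans (Δ-next i k k≢i) (cong suc Δ≡)))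
                    (sym (cong₂ _-_ (δ-≢ k≢i) (δ-≡ (sym (Δ≡0⇒≡ (next i) k Δ≡)))))
  ...   | suc _ = trans (cong cycleRow (trans (Δ-next i k k≢i) (cong suc Δ≡)))
                    (sym (cong₂ _-_ (δ-≢ k≢i) (δ-≢ k≢next)))
    where
    k≢next : toℕ k ≢ toℕ (next i)
    k≢next k≡next = ℕP.0≢1+n (trans (sym (trans (cong (offset (toℕ (next i))) k≡next) (Δ-self (next i)))) Δ≡)

  S-cols : ∀ k j → S k j ≡ δ (toℕ k) (toℕ j) - δ (toℕ k) (toℕ (prev j))
  S-cols k j with toℕ j ℕ.≟ toℕ k
  ... | yes j≡k = trans (cong cycleRow (trans (cong (offset (toℕ k)) j≡k) (Δ-self k)))
                    (sym (cong₂ _-_ (δ-≡ (sym j≡k)) (δ-≢ (λ k≡prev → prev≢ 1≤m j (trans (sym k≡prev) (sym j≡k))))))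
  ... | no j≢k with Δ k (prev j) in Δ≡
  ...   | zero  = trans (cong cycleRow (trans (Δ-prev k j j≢k) (cong suc Δ≡)))
                    (sym (cong₂ _-_ (δ-≢ (λ k≡j → j≢k (sym k≡j))) (δ-≡ (Δ≡0⇒≡ k (prev j) Δ≡))))
  ...   | suc _ = trans (cong cycleRow (trans (Δ-prev k j j≢k) (cong suc Δ≡)))
                    (sym (cong₂ _-_ (δ-≢ (λ k≡j → j≢k (sym k≡j))) (δ-≢ k≢prev)))
    where
    k≢prev : toℕ k ≢ toℕ (prev j)
    k≢prev k≡prev = ℕP.0≢1+n (trans (sym (trans (cong (offset (toℕ k)) (sym k≡prev)) (Δ-self k))) Δ≡)

  S-⊗ : ∀ B i j → (S ⊗ B) i j ≡ B i j - B (next i) j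
  S-⊗ B i j = begin
      Σ N (λ k → S i k * B k j)
    ≡⟨ Σ-cong N (λ k → trans (cong (_* B k j) (S-rows i k))
         (solve 3 (λ b x y → (x :- y) :* b := x :* b :- y :* b) refl (B k j) (δ (toℕ k) (toℕ i)) (δ (toℕ k) (toℕ (next i))))) ⟩
      Σ N (λ k → δ (toℕ k) (toℕ i) * B k j - δ (toℕ k) (toℕ (next i)) * B k j)
    ≡⟨ Σ-- N (λ k → δ (toℕ k) (toℕ i) * B k j) (λ k → δ (toℕ k) (toℕ (next i)) * B k j) ⟩
      Σ N (λ k → δ (toℕ k) (toℕ i) * B k j) - Σ N (λ k → δ (toℕ k) (toℕ (next i)) * B k j)
    ≡⟨ cong₂ _-_ (Σ-δ N i (λ k → B k j)) (Σ-δ N (next i) (λ k → B k j)) ⟩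
      B i j - B (next i) j
    ∎
    where open ≡-Reasoning

  ⊗-S : ∀ B i j → (B ⊗ S) i j ≡ B i j - B i (prev j)
  ⊗-S B i j = begin
      Σ N (λ k → B i k * S k j)
    ≡⟨ Σ-cong N (λ k → trans (cong (B i k *_) (S-cols k j))
         (solve 3 (λ b x y → b :* (x :- y) := x :* b :- y :* b) refl (B i k) (δ (toℕ k) (toℕ j)) (δ (toℕ k) (toℕ (prev j))))) ⟩
      Σ N (λ k → δ (toℕ k) (toℕ j) * B i k - δ (toℕ k) (toℕ (prev j)) * B i k)
    ≡⟨ Σ-- N (λ k → δ (toℕ k) (toℕ j) * B i k) (λ k → δ (toℕ k) (toℕ (prev j)) * B i k) ⟩
      Σ N (λ k → δ (toℕ k) (toℕ j) * B i k) - Σ N (λ k → δ (toℕ k) (toℕ (prev j)) * B i k)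
    ≡⟨ cong₂ _-_ (Σ-δ N j (λ k → B i k)) (Σ-δ N (prev j) (λ k → B i k)) ⟩
      B i j - B i (prev j)
    ∎
    where open ≡-Reasoning

  centring : Matrix N
  centring i j = δ (toℕ i) (toℕ j) - invN

  centring-sym : ∀ i j → centring i j ≡ centring j i
  centring-sym i j = cong (_- invN) (δ-sym (toℕ i) (toℕ j))

  centring-row-sum : ∀ i → Σ N (centring i) ≡ 0ℚ
  centring-row-sum i = begin
      Σ N (λ k → δ (toℕ i) (toℕ k) - invN)
    ≡⟨ Σ-cong N (λ k → cong (_- invN) (trans (δ-sym (toℕ i) (toℕ k)) (sym (ℚP.*-identityʳ _)))) ⟩
      Σ N (λ k → δ (toℕ k) (toℕ i) * 1ℚ - invN)
    ≡⟨ Σ-- N (λ k → δ (toℕ k) (toℕ i) * 1ℚ) (λ _ → invN) ⟩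
      Σ N (λ k → δ (toℕ k) (toℕ i) * 1ℚ) - Σ N (λ _ → invN)
    ≡⟨ cong₂ _-_ (Σ-δ N i (λ _ → 1ℚ)) (Σ-const N invN) ⟩
      1ℚ - ℕtoℚ N * invN
    ≡⟨ cong (1ℚ -_) (trans (ℚP.*-comm (ℕtoℚ N) invN) invN-inverse) ⟩
      1ℚ - 1ℚ
    ≡⟨ ℚP.+-inverseʳ 1ℚ ⟩
      0ℚ
    ∎
    where open ≡-Reasoning

  ⊗-centring : ∀ B i j → (B ⊗ centring) i j ≡ B i j - invN * Σ N (B i)
  ⊗-centring B i j = begin
      Σ N (λ k → B i k * (δ (toℕ k) (toℕ j) - invN))
    ≡⟨ Σ-cong N (λ k → solve 3 (λ b x ι → b :* (x :- ι) := x :* b :- ι :* b) refl (B i k) (δ (toℕ k) (toℕ j)) invN) ⟩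
      Σ N (λ k → δ (toℕ k) (toℕ j) * B i k - invN * B i k)
    ≡⟨ Σ-- N (λ k → δ (toℕ k) (toℕ j) * B i k) (λ k → invN * B i k) ⟩
      Σ N (λ k → δ (toℕ k) (toℕ j) * B i k) - Σ N (λ k → invN * B i k)
    ≡⟨ cong₂ _-_ (Σ-δ N j (B i)) (Σ-*ˡ N invN (B i)) ⟩
      B i j - invN * Σ N (B i)
    ∎
    where open ≡-Reasoning

  -- S ⊗ S⁺ is the centring matrix: off the diagonal the profile steps down by
  -- 1/N, on the diagonal it wraps around.
  S⊗S⁺ : S ⊗ S⁺ ≈ centring
  S⊗S⁺ i j with toℕ j ℕ.≟ toℕ i
  ... | no j≢i = begin
      (S ⊗ S⁺) i j                              ≡⟨ S-⊗ S⁺ i j ⟩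
      profile (Δ i j) - S⁺ (next i) j           ≡⟨ cong (λ x → profile x - S⁺ (next i) j) (Δ-next i j j≢i) ⟩
      profile (suc (Δ (next i) j)) - S⁺ (next i) j ≡⟨ profile-step (Δ (next i) j) ⟩
      0ℚ - invN                                 ≡⟨ cong (_- invN) (sym (δ-≢ (λ i≡j → j≢i (sym i≡j)))) ⟩
      centring i j                              ∎
    where open ≡-Reasoning
  ... | yes j≡i with toℕ-injective j≡i
  ...   | refl = begin
      (S ⊗ S⁺) i i                              ≡⟨ S-⊗ S⁺ i i ⟩
      profile (Δ i i) - profile (Δ (next i) i)  ≡⟨ cong₂ (λ x y → profile x - profile y) (Δ-self i) (Δ-next-self i) ⟩
      profile 0 - profile m                     ≡⟨ profile-wrap ⟩
      1ℚ - invN                                 ≡⟨ cong (_- invN) (sym (δ-≡ {toℕ i} refl)) ⟩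
      centring i i                              ∎
    where open ≡-Reasoning

  S⁺⊗S : S⁺ ⊗ S ≈ centring
  S⁺⊗S i j with toℕ j ℕ.≟ toℕ i
  ... | no j≢i = begin
      (S⁺ ⊗ S) i j                              ≡⟨ ⊗-S S⁺ i j ⟩
      profile (Δ i j) - S⁺ i (prev j)           ≡⟨ cong (λ x → profile x - S⁺ i (prev j)) (Δ-prev i j j≢i) ⟩
      profile (suc (Δ i (prev j))) - S⁺ i (prev j) ≡⟨ profile-step (Δ i (prev j)) ⟩
      0ℚ - invN                                 ≡⟨ cong (_- invN) (sym (δ-≢ (λ i≡j → j≢i (sym i≡j)))) ⟩
      centring i j                              ∎
    where open ≡-Reasoning
  ... | yes j≡i with toℕ-injective j≡i
  ...   | refl = begin
      (S⁺ ⊗ S) i i                              ≡⟨ ⊗-S S⁺ i i ⟩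
      profile (Δ i i) - profile (Δ i (prev i))  ≡⟨ cong₂ (λ x y → profile x - profile y) (Δ-self i) (Δ-prev-self i) ⟩
      profile 0 - profile m                     ≡⟨ profile-wrap ⟩
      1ℚ - invN                                 ≡⟨ cong (_- invN) (sym (δ-≡ {toℕ i} refl)) ⟩
      centring i i                              ∎
    where open ≡-Reasoning

  rowSum : Fin N → ℚ
  rowSum i = Σ N (S⁺ i)

  -- Summing S ⊗ S⁺ = centring along row i shows that consecutive rows of S⁺
  -- have equal sums ...
  rowSum-next : ∀ i → rowSum i ≡ rowSum (next i)
  rowSum-next i = x∙y⁻¹≈ε⇒x≈y (rowSum i) (rowSum (next i)) (begin
      rowSum i - rowSum (next i)              ≡⟨ sym (Σ-- N (S⁺ i) (S⁺ (next i))) ⟩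
      Σ N (λ j → S⁺ i j - S⁺ (next i) j)      ≡⟨ Σ-cong N (λ j → sym (S-⊗ S⁺ i j)) ⟩
      Σ N (λ j → (S ⊗ S⁺) i j)                ≡⟨ Σ-cong N (S⊗S⁺ i) ⟩
      Σ N (centring i)                        ≡⟨ centring-row-sum i ⟩
      0ℚ                                      ∎)
    where open ≡-Reasoning

  rowSum-constant : ∀ i → rowSum i ≡ rowSum F.zero
  rowSum-constant i = trans (cong rowSum (sym (fromℕ<-toℕ i (toℕ<n i)))) (walk (toℕ i) (toℕ<n i))
    where
    walk : ∀ t (t<N : t < N) → rowSum (F.fromℕ< t<N) ≡ rowSum F.zero
    walk zero    t<N   = refl
    walk (suc t) t+1<N = begin
        rowSum (F.fromℕ< t+1<N)          ≡⟨ cong rowSum (sym (next-fromℕ< t<N t+1<N)) ⟩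
        rowSum (next (F.fromℕ< t<N))     ≡⟨ sym (rowSum-next (F.fromℕ< t<N)) ⟩
        rowSum (F.fromℕ< t<N)            ≡⟨ walk t t<N ⟩
        rowSum F.zero                    ∎
      where
      open ≡-Reasoning
      t<N : t < N
      t<N = ℕP.<-trans (ℕP.n<1+n t) t+1<N

  -- The first row is (c₀ − k/N)_k; twice its sum is N · (N − 1)/N − (N² − N)/N = 0
  -- by Gauss's formula.
  rowSum-first : rowSum F.zero ≡ 0ℚ
  rowSum-first = begin
      Σ N (λ k → profile (Δ F.zero k))                ≡⟨ Σ-cong N (λ k → trans (cong profile (Δ-forward F.zero k z≤n)) (profile-linear (toℕ k))) ⟩
      Σ N (λ k → c₀ - ℕtoℚ (toℕ k) * invN)            ≡⟨ Σ-- N (λ _ → c₀) (λ k → ℕtoℚ (toℕ k) * invN) ⟩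
      Σ N (λ _ → c₀) - Σ N (λ k → ℕtoℚ (toℕ k) * invN) ≡⟨ cong₂ _-_ (Σ-const N c₀) (Σ-*ʳ N invN (λ k → ℕtoℚ (toℕ k))) ⟩
      ℕtoℚ N * c₀ - G * invN                          ≡⟨ cong (_- G * invN) (halve (ℕtoℚ N * c₀) (G * invN) (trans N·c₀-double (sym G·invN-double))) ⟩
      G * invN - G * invN                             ≡⟨ ℚP.+-inverseʳ (G * invN) ⟩
      0ℚ                                              ∎
    where
    open ≡-Reasoning
    G : ℚ
    G = Σ N (λ k → ℕtoℚ (toℕ k))

    halve : ∀ x y → x + x ≡ y + y → x ≡ y
    halve x y 2x≡2y = begin
        x                     ≡⟨ solve 1 (λ x → x := (x :+ x) :* con (+ 1 / 2)) refl x ⟩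
        (x + x) * (+ 1 / 2)   ≡⟨ cong (_* (+ 1 / 2)) 2x≡2y ⟩
        (y + y) * (+ 1 / 2)   ≡⟨ solve 1 (λ y → (y :+ y) :* con (+ 1 / 2) := y) refl y ⟩
        y                     ∎

    N·invN : ℕtoℚ N * invN ≡ 1ℚ
    N·invN = trans (ℚP.*-comm (ℕtoℚ N) invN) invN-inverse

    N·c₀-double : ℕtoℚ N * c₀ + ℕtoℚ N * c₀ ≡ ℕtoℚ m
    N·c₀-double = begin
        ℕtoℚ N * c₀ + ℕtoℚ N * c₀      ≡⟨ sym (ℚP.*-distribˡ-+ (ℕtoℚ N) c₀ c₀) ⟩
        ℕtoℚ N * (c₀ + c₀)             ≡⟨ cong (ℕtoℚ N *_) c₀-double ⟩
        ℕtoℚ N * (ℕtoℚ m * invN)       ≡⟨ solve 3 (λ n k ι → n :* (k :* ι) := k :* (n :* ι)) refl (ℕtoℚ N) (ℕtoℚ m) invN ⟩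
        ℕtoℚ m * (ℕtoℚ N * invN)       ≡⟨ cong (ℕtoℚ m *_) N·invN ⟩
        ℕtoℚ m * 1ℚ                    ≡⟨ ℚP.*-identityʳ (ℕtoℚ m) ⟩
        ℕtoℚ m                         ∎

    G·invN-double : G * invN + G * invN ≡ ℕtoℚ m
    G·invN-double = begin
        G * invN + G * invN                        ≡⟨ sym (ℚP.*-distribʳ-+ invN G G) ⟩
        (G + G) * invN                             ≡⟨ cong (_* invN) (Σ-index-double N) ⟩
        (ℕtoℚ N * ℕtoℚ N - ℕtoℚ N) * invN           ≡⟨ solve 2 (λ n ι → (n :* n :- n) :* ι := n :* (n :* ι) :- n :* ι) refl (ℕtoℚ N) invN ⟩
        ℕtoℚ N * (ℕtoℚ N * invN) - ℕtoℚ N * invN    ≡⟨ cong₂ (λ u v → ℕtoℚ N * u - v) N·invN N·invN ⟩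
        ℕtoℚ N * 1ℚ - 1ℚ                           ≡⟨ cong (λ n → n * 1ℚ - 1ℚ) (ℕtoℚ-suc m) ⟩
        (1ℚ + ℕtoℚ m) * 1ℚ - 1ℚ                    ≡⟨ solve 1 (λ k → (con 1ℚ :+ k) :* con 1ℚ :- con 1ℚ := k) refl (ℕtoℚ m) ⟩
        ℕtoℚ m                                     ∎

  S⁺-row-sum : ∀ i → Σ N (S⁺ i) ≡ 0ℚ
  S⁺-row-sum i = trans (rowSum-constant i) rowSum-first

  S⁺-isPseudoinverse : IsPseudoinverse S S⁺
  S⁺-isPseudoinverse = S⊗S⁺⊗S , S⁺⊗S⊗S⁺ , S⊗S⁺-symmetric , S⁺⊗S-symmetric
    where
    open ≡-Reasoning
    S⊗S⁺⊗S : ∀ i j → ((S ⊗ S⁺) ⊗ S) i j ≡ S i j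
    S⊗S⁺⊗S i j = begin
        ((S ⊗ S⁺) ⊗ S) i j                              ≡⟨ ⊗-congʳ S S⊗S⁺ i j ⟩
        (centring ⊗ S) i j                              ≡⟨ ⊗-S centring i j ⟩
        centring i j - centring i (prev j)              ≡⟨ solve 3 (λ x y ι → (x :- ι) :- (y :- ι) := x :- y) refl
                                                             (δ (toℕ i) (toℕ j)) (δ (toℕ i) (toℕ (prev j))) invN ⟩
        δ (toℕ i) (toℕ j) - δ (toℕ i) (toℕ (prev j))    ≡⟨ sym (S-cols i j) ⟩
        S i j                                           ∎

    S⁺⊗S⊗S⁺ : ∀ i j → ((S⁺ ⊗ S) ⊗ S⁺) i j ≡ S⁺ i j
    S⁺⊗S⊗S⁺ i j = begin
        ((S⁺ ⊗ S) ⊗ S⁺) i j             ≡⟨ ⊗-assoc S⁺ S S⁺ i j ⟩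
        (S⁺ ⊗ (S ⊗ S⁺)) i j             ≡⟨ ⊗-congˡ S⁺ S⊗S⁺ i j ⟩
        (S⁺ ⊗ centring) i j             ≡⟨ ⊗-centring S⁺ i j ⟩
        S⁺ i j - invN * Σ N (S⁺ i)      ≡⟨ cong (λ s → S⁺ i j - invN * s) (S⁺-row-sum i) ⟩
        S⁺ i j - invN * 0ℚ              ≡⟨ solve 2 (λ x ι → x :- ι :* con 0ℚ := x) refl (S⁺ i j) invN ⟩
        S⁺ i j                          ∎

    S⊗S⁺-symmetric : ∀ i j → transpose (S ⊗ S⁺) i j ≡ (S ⊗ S⁺) i j
    S⊗S⁺-symmetric i j = trans (S⊗S⁺ j i) (trans (centring-sym j i) (sym (S⊗S⁺ i j)))

    S⁺⊗S-symmetric : ∀ i j → transpose (S⁺ ⊗ S) i j ≡ (S⁺ ⊗ S) i j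
    S⁺⊗S-symmetric i j = trans (S⁺⊗S j i) (trans (centring-sym j i) (sym (S⁺⊗S i j)))

open import Defs
open import Data.Nat using (suc; _∸_; _*_; z≤n; s≤s)
open import Data.Fin using (Fin; toℕ)
open import Data.Integer using (+_)
open import Data.Rational using (_-_)
open import Data.Product using (Σ-syntax; _×_; _,_)
open import Relation.Binary.PropositionalEquality using (_≡_; trans)
open PiecewisePolynomials using (pieces-cong)

-- S⁺ is a pseudoinverse; any other pseudoinverse X coincides with it, so X
-- inherits the entry formula and the piecewise linearity of S⁺.
lemma4p1 : (N : ℕ) → 3 ≤ N →
    (Σ[ X ∈ Matrix N ] IsPseudoinverse (S-C N) X) ×
    ((X : Matrix N) → IsPseudoinverse (S-C N) X →
      ((i j : Fin N) → toℕ i ≤ toℕ j →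
        X i j ≡ ((+ (N ∸ 1)) // (2 * N)) - ((+ (toℕ j ∸ toℕ i)) // N)) ×
      ((i : Fin N) → PiecewiseLinear (λ j → X i j)) ×
      ((j : Fin N) → PiecewiseLinear (λ i → X i j)))
lemma4p1 (suc (suc (suc n))) (s≤s (s≤s (s≤s _))) =
  (S⁺ , S⁺-isPseudoinverse) , λ X X⁺ →
    let X≈S⁺ = pinv-unique X⁺ S⁺-isPseudoinverse in
      (λ i j i≤j → trans (X≈S⁺ i j) (S⁺-above i j i≤j))
    , (λ i → pieces-cong (X≈S⁺ i) (S⁺-rows-linear i))
    , (λ j → pieces-cong (λ i → X≈S⁺ i j) (S⁺-cols-linear j))
  where
  m = suc (suc n)
  open Profile m using (S⁺; S⁺-above; S⁺-rows-linear; S⁺-cols-linear)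
  open Pseudoinverse m (s≤s z≤n) using (S⁺-isPseudoinverse)
  open Matrices (suc m) using (pinv-unique)
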